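{- Let $d\ge 1$ and $r\ge 1$ be integers and let $\tilde G$ be the edge-weighted graph with vertex set $\{x\in\mathbb{Z}^d:\|x\|_1\le r\}$ and edge set $E_0\cup E_{\mathrm{sp}}$, where $E_0=\{(u,v):\|u-v\|_1=1\}$ (each of weight $1$) and $E_{\mathrm{sp}}=\{(u,v):u=-v,\ \|u\|_1=r\}$ (special edges, each of weight $0$). Let $u,v$ be vertices of $\tilde G$ and let $P$ be a walk from $u$ to $v$ in $\tilde G$. If the number of special edges traversed by $P$ is even, then $\ell(P)\ge \|u-v\|_1$, where $\ell(P)$ is the total weight of the edges traversed by $P$.
   Context: A walk from $u$ to $v$ is a sequence of vertices starting at $u$ and ending at $v$ in which consecutive vertices are joined by an edge of $\tilde G$; edges are counted with multiplicity both in the length and in the count of special edges. -}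

module Defs where

open import Data.Nat using (ℕ; zero; suc; _+_; _≤_)
open import Data.Integer using (ℤ; ∣_∣; _-_; -_)
open import Data.Vec using (Vec; []; _∷_; zipWith; map; foldr)
open import Relation.Binary.PropositionalEquality using (_≡_)

Point : ℕ → Set
Point d = Vec ℤ d

‖_‖₁ : ∀ {d} → Point d → ℕ
‖ x ‖₁ = foldr _ (λ a s → ∣ a ∣ + s) 0 x

_⊖_ : ∀ {d} → Point d → Point d → Point d
u ⊖ v = zipWith _-_ u v

neg : ∀ {d} → Point d → Point d
neg = map (λ a → - a)

IsVertex : ∀ {d} → ℕ → Point d → Set
IsVertex r x = ‖ x ‖₁ ≤ r

-- edges of G̃ between two vertices (vertex membership is tracked in Walk)
-- ordinary edges E₀ (weight 1) and special edges E_sp (weight 0)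
data Edge {d : ℕ} (r : ℕ) (u v : Point d) : Set where
  ordinary : ‖ u ⊖ v ‖₁ ≡ 1 → Edge r u v
  special  : u ≡ neg v → ‖ u ‖₁ ≡ r → Edge r u v

weight : ∀ {d r} {u v : Point d} → Edge r u v → ℕ
weight (ordinary _)  = 1
weight (special _ _) = 0

isSpecial : ∀ {d r} {u v : Point d} → Edge r u v → ℕ
isSpecial (ordinary _)  = 0
isSpecial (special _ _) = 1

data Walk {d : ℕ} (r : ℕ) : Point d → Point d → Set where
  stop : ∀ {u} → IsVertex r u → Walk r u u
  step : ∀ {u w v} → IsVertex r u → Edge r u w → Walk r w v → Walk r u v

len : ∀ {d r} {u v : Point d} → Walk r u v → ℕ
len (stop _)     = 0
len (step _ e p) = weight e + len p

specials : ∀ {d r} {u v : Point d} → Walk r u v → ℕ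
specials (stop _)     = 0
specials (step _ e p) = isSpecial e + specials p

{-# OPTIONS --safe #-}
module Submission where

-- A special edge u → −u is ℓ¹-free once the target is reflected as well, since
-- reflection x ↦ −x is an ℓ¹-isometry. So along any walk P from u to v, the
-- triangle inequality gives ℓ(P) ≥ ‖u − (−1)^s v‖₁ with s the number of special
-- edges; for even s the reflection disappears.

open import Defs
open import Data.Nat using (ℕ; zero; suc; _+_; _≤_; _≥_; _%_; z≤n; s≤s)
open import Data.Nat.Properties using (+-mono-≤; +-commutativeSemigroup; ≤-reflexive; module ≤-Reasoning)
open import Data.Integer as ℤ using (∣_∣)
open import Data.Integer.Properties using (∣i+j∣≤∣i∣+∣j∣; +-minus-telescope; +-inverseʳ; ∣-i∣≡∣i∣; neg-distrib-+; neg-involutive)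
open import Data.Vec using ([]; _∷_)
open import Data.Vec.Properties using (map-∘; map-cong; map-id)
open import Algebra.Properties.CommutativeSemigroup +-commutativeSemigroup using (interchange)
open import Relation.Binary.PropositionalEquality using (_≡_; refl; sym; trans; cong; cong₂)

‖⊖‖-triangle : ∀ {d} (a b c : Point d) → ‖ a ⊖ c ‖₁ ≤ ‖ a ⊖ b ‖₁ + ‖ b ⊖ c ‖₁
‖⊖‖-triangle []      []      []      = z≤n
‖⊖‖-triangle (x ∷ a) (y ∷ b) (z ∷ c) = begin
  ∣ x ℤ.- z ∣ + ‖ a ⊖ c ‖₁
    ≡⟨ cong (λ t → ∣ t ∣ + ‖ a ⊖ c ‖₁) (+-minus-telescope x y z) ⟨
  ∣ (x ℤ.- y) ℤ.+ (y ℤ.- z) ∣ + ‖ a ⊖ c ‖₁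
    ≤⟨ +-mono-≤ (∣i+j∣≤∣i∣+∣j∣ (x ℤ.- y) (y ℤ.- z)) (‖⊖‖-triangle a b c) ⟩
  (∣ x ℤ.- y ∣ + ∣ y ℤ.- z ∣) + (‖ a ⊖ b ‖₁ + ‖ b ⊖ c ‖₁)
    ≡⟨ interchange ∣ x ℤ.- y ∣ ∣ y ℤ.- z ∣ ‖ a ⊖ b ‖₁ ‖ b ⊖ c ‖₁ ⟩
  (∣ x ℤ.- y ∣ + ‖ a ⊖ b ‖₁) + (∣ y ℤ.- z ∣ + ‖ b ⊖ c ‖₁) ∎
  where open ≤-Reasoning

‖a⊖a‖≡0 : ∀ {d} (a : Point d) → ‖ a ⊖ a ‖₁ ≡ 0
‖a⊖a‖≡0 []      = refl
‖a⊖a‖≡0 (x ∷ a) = cong₂ _+_ (cong ∣_∣ (+-inverseʳ x)) (‖a⊖a‖≡0 a)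

‖neg⊖neg‖≡‖⊖‖ : ∀ {d} (a b : Point d) → ‖ neg a ⊖ neg b ‖₁ ≡ ‖ a ⊖ b ‖₁
‖neg⊖neg‖≡‖⊖‖ []      []      = refl
‖neg⊖neg‖≡‖⊖‖ (x ∷ a) (y ∷ b) = cong₂ _+_ ∣-x--y∣≡∣x-y∣ (‖neg⊖neg‖≡‖⊖‖ a b)
  where
  ∣-x--y∣≡∣x-y∣ : ∣ ℤ.- x ℤ.- ℤ.- y ∣ ≡ ∣ x ℤ.- y ∣
  ∣-x--y∣≡∣x-y∣ = trans (cong ∣_∣ (sym (neg-distrib-+ x (ℤ.- y)))) (∣-i∣≡∣i∣ (x ℤ.- y))

neg-neg : ∀ {d} (a : Point d) → neg (neg a) ≡ a
neg-neg a = trans (sym (map-∘ ℤ.-_ ℤ.-_ a)) (trans (map-cong neg-involutive a) (map-id a))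

neg^ : ∀ {d} → ℕ → Point d → Point d
neg^ zero    a = a
neg^ (suc n) a = neg (neg^ n a)

neg^-even : ∀ {d} n (a : Point d) → n % 2 ≡ 0 → neg^ n a ≡ a
neg^-even zero          a _    = refl
neg^-even (suc zero)    a ()
-- (2 + n) % 2 reduces to n % 2 definitionally, so the hypothesis passes through unchanged.
neg^-even (suc (suc n)) a even = trans (neg-neg (neg^ n a)) (neg^-even n a even)

‖⊖neg^specials‖≤len : ∀ {d r} {u v : Point d} (P : Walk r u v) → ‖ u ⊖ neg^ (specials P) v ‖₁ ≤ len P
‖⊖neg^specials‖≤len {u = u} (stop _) = ≤-reflexive (‖a⊖a‖≡0 u)
‖⊖neg^specials‖≤len {u = u} {v} (step {w = w} _ (ordinary ‖u⊖w‖≡1) Q) = begin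
  ‖ u ⊖ v′ ‖₁                ≤⟨ ‖⊖‖-triangle u w v′ ⟩
  ‖ u ⊖ w ‖₁ + ‖ w ⊖ v′ ‖₁  ≡⟨ cong (_+ ‖ w ⊖ v′ ‖₁) ‖u⊖w‖≡1 ⟩
  suc ‖ w ⊖ v′ ‖₁            ≤⟨ s≤s (‖⊖neg^specials‖≤len Q) ⟩
  suc (len Q)                ∎
  where
  open ≤-Reasoning
  v′ = neg^ (specials Q) v
‖⊖neg^specials‖≤len {v = v} (step {w = w} _ (special refl _) Q) = begin
  ‖ neg w ⊖ neg (neg^ (specials Q) v) ‖₁ ≡⟨ ‖neg⊖neg‖≡‖⊖‖ w (neg^ (specials Q) v) ⟩
  ‖ w ⊖ neg^ (specials Q) v ‖₁           ≤⟨ ‖⊖neg^specials‖≤len Q ⟩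
  len Q                                   ∎
  where open ≤-Reasoning

claim1 : (d r : ℕ) → d ≥ 1 → r ≥ 1 → (u v : Point d) → (P : Walk r u v) → specials P % 2 ≡ 0 → len P ≥ ‖ u ⊖ v ‖₁
claim1 d r _ _ u v P even = begin
  ‖ u ⊖ v ‖₁                      ≡⟨ cong (λ t → ‖ u ⊖ t ‖₁) (neg^-even (specials P) v even) ⟨
  ‖ u ⊖ neg^ (specials P) v ‖₁    ≤⟨ ‖⊖neg^specials‖≤len P ⟩
  len P                           ∎
  where open ≤-Reasoning
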